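{- Let $q_1,q_2,\dots,q_k$ be distinct primes and let $j_1,j_2,\dots,j_k$ be positive integers. Then $p=q_1^{j_1}q_2^{j_2}\cdots q_k^{j_k}$ is product-admissible if and only if there exists a nonzero polynomial $\chi\in\mathbb{Z}[z_1,\dots,z_k]$ such that: (i) $\chi(q_1,q_2,\dots,q_k)=0$; (ii) $\chi_\ell(1,1,\dots,1)=0$ for each $1\leq\ell\leq k$, where $\chi_\ell$ denotes the partial derivative of $\chi$ with respect to the $\ell$-th variable $z_\ell$; (iii) for each $1\leq\ell\leq k$, the sum of the absolute values of the coefficients of $\chi_\ell$ is at most $2j_\ell$; (iv) $\chi(1,1,\dots,1)=0$.
   Context: For a multiset $\{x_1,\dots,x_n\}$ of positive integers define $T\{x_1,\dots,x_n\}=(x_1+\cdots+x_n,\,x_1x_2\cdots x_n,\,n)$. An ordered triple $(s,p,n)$ of positive integers is called admissible if there exist at least two different multisets $X$, $Y$ of $n$ positive integers with $T(X)=T(Y)=(s,p,n)$. A positive integer $p$ is product-admissible if there exist positive integers $s$ and $n$ such that $(s,p,n)$ is admissible. -}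

module Defs where

open import Data.Nat as ℕ using (ℕ; zero; suc; _≤_; _<_)
open import Data.Integer as ℤ using (ℤ; +_; ∣_∣)
open import Data.Fin using (Fin)
open import Data.Nat.ListAction using (sum; product)
open import Data.List as List using (List; []; _∷_; length)
open import Data.List.Relation.Unary.All as ListAll using ()
open import Data.List.Relation.Binary.Permutation.Propositional using (_↭_)
open import Data.Vec as Vec using (Vec; []; _∷_; lookup; updateAt; replicate)
open import Data.Vec.Relation.Unary.All as VecAll using ()
open import Data.Product using (Σ; ∃; _×_; _,_)
open import Relation.Binary.PropositionalEquality using (_≡_; _≢_)
open import Relation.Nullary using (¬_)

-- Multisets of positive integers are represented by lists up to
-- permutation (_↭_).

HasT : List ℕ → ℕ → ℕ → ℕ → Set
HasT X s p n =
  length X ≡ n × ListAll.All (λ x → 1 ≤ x) X × sum X ≡ s × product X ≡ p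

Admissible : ℕ → ℕ → ℕ → Set
Admissible s p n =
  1 ≤ s × 1 ≤ p × 1 ≤ n ×
  Σ (List ℕ) λ X → Σ (List ℕ) λ Y → HasT X s p n × HasT Y s p n × ¬ (X ↭ Y)

ProductAdmissible : ℕ → Set
ProductAdmissible p = Σ ℕ λ s → Σ ℕ λ n → Admissible s p n

-- Polynomials in ℤ[z₁,…,z_k] are given by a coefficient function on
-- exponent vectors together with a bound d such that all coefficients
-- vanish outside the box {0,…,d}^k.

Coeffs : ℕ → Set
Coeffs k = Vec ℕ k → ℤ

box : (k d : ℕ) → List (Vec ℕ k)
box zero    d = [] ∷ []
box (suc k) d = List.concatMap (λ i → List.map (i ∷_) (box k d)) (List.upTo (suc d))

SupportedIn : {k : ℕ} → ℕ → Coeffs k → Set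
SupportedIn {k} d c = ∀ (e : Vec ℕ k) → ¬ VecAll.All (λ i → i ≤ d) e → c e ≡ + 0

NonzeroPoly : {k : ℕ} → Coeffs k → Set
NonzeroPoly {k} c = ∃ λ (e : Vec ℕ k) → c e ≢ + 0

monomial : {k : ℕ} → Vec ℤ k → Vec ℕ k → ℤ
monomial []       []       = + 1
monomial (x ∷ xs) (e ∷ es) = (x ℤ.^ e) ℤ.* monomial xs es

sumℤ : List ℤ → ℤ
sumℤ = List.foldr ℤ._+_ (+ 0)

eval : {k : ℕ} → ℕ → Coeffs k → Vec ℤ k → ℤ
eval {k} d c x = sumℤ (List.map (λ e → c e ℤ.* monomial x e) (box k d))

partial : {k : ℕ} → Fin k → Coeffs k → Coeffs k
partial ℓ c e = + suc (lookup e ℓ) ℤ.* c (updateAt e ℓ suc)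

absCoeffSum : {k : ℕ} → ℕ → Coeffs k → ℕ
absCoeffSum {k} d c = sum (List.map (λ e → ∣ c e ∣) (box k d))

ones : (k : ℕ) → Vec ℤ k
ones k = replicate k (+ 1)

toℤ : {k : ℕ} → Vec ℕ k → Vec ℤ k
toℤ = Vec.map +_

prodPow : {k : ℕ} → Vec ℕ k → Vec ℕ k → ℕ
prodPow q j = product (Vec.toList (Vec.zipWith ℕ._^_ q j))

-- A divisor of p = ∏ qₗ^jₗ is q^e for an exponent vector e, so by unique factorisation a
-- multiset of divisors with product p is a multiset of exponent vectors summing to j.  For
-- two such multisets X ≠ Y with the same T, χ = Σ_{e∈X} z^e − Σ_{e∈Y} z^e is nonzero, and
-- χ(q), χ(1), ∂ℓχ(1) are the differences of the sums, of the sizes and of the ℓ-th exponent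
-- sums, hence 0; the absolute values of the coefficients of ∂ℓχ add up to at most
-- Σ_{e∈X} eₗ + Σ_{e∈Y} eₗ = 2jₗ.  Conversely, the positive and negative parts of χ are
-- multisets X ≠ Y of exponent vectors with equal sums, sizes and exponent sums t; since the
-- parts have disjoint supports, (iii) reads 2tₗ ≤ 2jₗ, and adjoining the common element
-- q^(j−t) to both gives two different multisets of divisors with product p.

module Submission where

open import Defs
open import Data.Nat as ℕ using (ℕ; zero; suc; _+_; _*_; _∸_; _^_; _≤_; _<_; z≤n; s≤s; NonZero)
import Data.Nat.Properties as NP
open import Algebra.Properties.CommutativeSemigroup NP.+-commutativeSemigroup using ()
  renaming (interchange to +-interchange)
open import Algebra.Properties.CommutativeSemigroup NP.*-commutativeSemigroup using ()
  renaming (interchange to *-interchange)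
open import Data.Nat.Divisibility using (_∣_; divides; _∣?_; ∣-trans; ∣-reflexive; ∣1⇒≡1; m∣m*n; n∣m*n; *-cancelˡ-∣)
open import Data.Nat.Coprimality using (Coprime; coprime-divisor)
open import Data.Nat.Primality using (Prime; prime⇒nonZero; prime⇒nonTrivial; prime⇒irreducible; euclidsLemma)
open import Data.Nat.ListAction using (sum; product)
import Data.Nat.ListAction.Properties as NLP
open import Data.Integer as ℤ using (ℤ; +_; -[1+_]; _⊖_; ∣_∣)
import Data.Integer.Properties as ZP
open import Data.Integer.Tactic.RingSolver using (solve-∀)
open import Data.Fin using (Fin; zero; suc)
import Data.Fin.Properties as FinP
open import Data.List as List using (List; []; _∷_; _++_; map; concatMap; length; applyUpTo; upTo)
import Data.List.Properties as ListP
open import Data.List.Relation.Unary.All as All using (All; []; _∷_)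
import Data.List.Relation.Unary.All.Properties as AllP
open import Data.List.Relation.Unary.Any as Any using (here; there)
open import Data.List.Membership.Propositional using (_∈_)
import Data.List.Membership.Propositional.Properties as ∈P
open import Data.List.Relation.Binary.Permutation.Propositional using (_↭_; ↭-refl; ↭-sym; ↭-trans; ↭-prep)
import Data.List.Relation.Binary.Permutation.Propositional.Properties as ↭P
open import Data.Vec as Vec using (Vec; []; _∷_; lookup; zipWith; replicate)
import Data.Vec.Properties as VecP
open import Data.Vec.Relation.Unary.All as VecAll using ([]; _∷_)
open import Data.Product using (Σ; ∃; ∃₂; _×_; _,_; proj₁; proj₂)
open import Data.Sum using (_⊎_; inj₁; inj₂)
open import Data.Empty using (⊥-elim)
open import Function using (id; _∘_)
open import Function.Bundles using (_⇔_; mk⇔)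
open import Relation.Nullary using (¬_; Dec; yes; no; ¬?)
open import Relation.Binary.PropositionalEquality
open ≡-Reasoning

module _ {A : Set} where

  sum-map-+ : (f g : A → ℕ) (xs : List A) →
              sum (map (λ x → f x + g x) xs) ≡ sum (map f xs) + sum (map g xs)
  sum-map-+ f g []       = refl
  sum-map-+ f g (x ∷ xs) = begin
    f x + g x + sum (map (λ x → f x + g x) xs)    ≡⟨ cong (_+_ (f x + g x)) (sum-map-+ f g xs) ⟩
    f x + g x + (sum (map f xs) + sum (map g xs)) ≡⟨ +-interchange (f x) (g x) _ _ ⟩
    f x + sum (map f xs) + (g x + sum (map g xs)) ∎

  sum-map-*ˡ : (c : ℕ) (f : A → ℕ) (xs : List A) →
               sum (map (λ x → c * f x) xs) ≡ c * sum (map f xs)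
  sum-map-*ˡ c f []       = sym (NP.*-zeroʳ c)
  sum-map-*ˡ c f (x ∷ xs) = begin
    c * f x + sum (map (λ x → c * f x) xs) ≡⟨ cong (_+_ (c * f x)) (sum-map-*ˡ c f xs) ⟩
    c * f x + c * sum (map f xs)           ≡⟨ NP.*-distribˡ-+ c (f x) _ ⟨
    c * (f x + sum (map f xs))             ∎

  sum-map-zero : (f : A → ℕ) → (∀ x → f x ≡ 0) → (xs : List A) → sum (map f xs) ≡ 0
  sum-map-zero f f≡0 []       = refl
  sum-map-zero f f≡0 (x ∷ xs) = cong₂ _+_ (f≡0 x) (sum-map-zero f f≡0 xs)

  sum-map-mono : {f g : A → ℕ} → (∀ x → f x ≤ g x) → (xs : List A) →
                 sum (map f xs) ≤ sum (map g xs)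
  sum-map-mono f≤g []       = z≤n
  sum-map-mono f≤g (x ∷ xs) = NP.+-mono-≤ (f≤g x) (sum-map-mono f≤g xs)

  sum-map-1 : (xs : List A) → sum (map (λ _ → 1) xs) ≡ length xs
  sum-map-1 []       = refl
  sum-map-1 (x ∷ xs) = cong suc (sum-map-1 xs)

  sum-map-replicate : (f : A → ℕ) (m : ℕ) (x : A) →
                      sum (map f (List.replicate m x)) ≡ m * f x
  sum-map-replicate f zero    x = refl
  sum-map-replicate f (suc m) x = cong (_+_ (f x)) (sum-map-replicate f m x)

  sum-map-concatMap : {B : Set} (f : B → ℕ) (g : A → List B) (xs : List A) →
                      sum (map f (concatMap g xs)) ≡ sum (map (λ x → sum (map f (g x))) xs)
  sum-map-concatMap f g []       = refl
  sum-map-concatMap f g (x ∷ xs) = begin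
    sum (map f (g x ++ concatMap g xs))              ≡⟨ cong sum (ListP.map-++ f (g x) _) ⟩
    sum (map f (g x) ++ map f (concatMap g xs))      ≡⟨ NLP.sum-++ (map f (g x)) _ ⟩
    sum (map f (g x)) + sum (map f (concatMap g xs))
      ≡⟨ cong (_+_ (sum (map f (g x)))) (sum-map-concatMap f g xs) ⟩
    sum (map f (g x)) + sum (map (λ x → sum (map f (g x))) xs) ∎

δ : ℕ → ℕ → ℕ
δ zero    zero    = 1
δ zero    (suc _) = 0
δ (suc _) zero    = 0
δ (suc m) (suc n) = δ m n

δ-refl : ∀ n → δ n n ≡ 1
δ-refl zero    = refl
δ-refl (suc n) = δ-refl n

δ-≢ : ∀ {m n} → m ≢ n → δ m n ≡ 0
δ-≢ {zero}  {zero}  m≢n = ⊥-elim (m≢n refl)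
δ-≢ {zero}  {suc n} m≢n = refl
δ-≢ {suc m} {zero}  m≢n = refl
δ-≢ {suc m} {suc n} m≢n = δ-≢ (m≢n ∘ cong suc)

δ-sym : ∀ m n → δ m n ≡ δ n m
δ-sym zero    zero    = refl
δ-sym zero    (suc n) = refl
δ-sym (suc m) zero    = refl
δ-sym (suc m) (suc n) = δ-sym m n

δᵛ : ∀ {k} → Vec ℕ k → Vec ℕ k → ℕ
δᵛ []      []      = 1
δᵛ (m ∷ u) (n ∷ v) = δ m n * δᵛ u v

δᵛ-refl : ∀ {k} (v : Vec ℕ k) → δᵛ v v ≡ 1
δᵛ-refl []      = refl
δᵛ-refl (n ∷ v) = cong₂ _*_ (δ-refl n) (δᵛ-refl v)

δᵛ-≢ : ∀ {k} {u v : Vec ℕ k} → u ≢ v → δᵛ u v ≡ 0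
δᵛ-≢ {u = []}    {[]}    u≢v = ⊥-elim (u≢v refl)
δᵛ-≢ {u = m ∷ u} {n ∷ v} u≢v with m ℕ.≟ n
... | no  m≢n  = cong (_* δᵛ u v) (δ-≢ m≢n)
... | yes refl = trans (cong (δ m m *_) (δᵛ-≢ (u≢v ∘ cong (m ∷_)))) (NP.*-zeroʳ (δ m m))

δᵛ-sym : ∀ {k} (u v : Vec ℕ k) → δᵛ u v ≡ δᵛ v u
δᵛ-sym []      []      = refl
δᵛ-sym (m ∷ u) (n ∷ v) = cong₂ _*_ (δ-sym m n) (δᵛ-sym u v)

_≟ᵛ_ : ∀ {k} (u v : Vec ℕ k) → Dec (u ≡ v)
_≟ᵛ_ = VecP.≡-dec ℕ._≟_

δ-injective : ∀ {k} (f : Vec ℕ k → ℕ) → (∀ {u v} → f u ≡ f v → u ≡ v) →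
              ∀ u v → δ (f u) (f v) ≡ δᵛ u v
δ-injective f f-inj u v with u ≟ᵛ v
... | yes refl = trans (δ-refl (f u)) (sym (δᵛ-refl u))
... | no  u≢v  = trans (δ-≢ (u≢v ∘ f-inj)) (sym (δᵛ-≢ u≢v))

multiplicity : ∀ {k} → Vec ℕ k → List (Vec ℕ k) → ℕ
multiplicity e xs = sum (map (δᵛ e) xs)

multiplicity-↭ : ∀ {k} (e : Vec ℕ k) {xs ys} → xs ↭ ys → multiplicity e xs ≡ multiplicity e ys
multiplicity-↭ e xs↭ys = NLP.sum-↭ (↭P.map⁺ (δᵛ e) xs↭ys)

multiplicity-∷-self : ∀ {k} (v : Vec ℕ k) xs → multiplicity v (v ∷ xs) ≡ suc (multiplicity v xs)
multiplicity-∷-self v xs = cong (_+ multiplicity v xs) (δᵛ-refl v)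

multiplicity-map-∷ : ∀ {k} m n (e : Vec ℕ k) xs →
                     multiplicity (m ∷ e) (map (n ∷_) xs) ≡ δ m n * multiplicity e xs
multiplicity-map-∷ m n e xs = trans (cong sum (sym (ListP.map-∘ xs))) (sum-map-*ˡ (δ m n) (δᵛ e) xs)

multiplicity≢0⇒∈ : ∀ {k} {e : Vec ℕ k} xs → multiplicity e xs ≢ 0 → e ∈ xs
multiplicity≢0⇒∈         []       ≢0 = ⊥-elim (≢0 refl)
multiplicity≢0⇒∈ {e = e} (v ∷ xs) ≢0 with e ≟ᵛ v
... | yes e≡v = here e≡v
... | no  e≢v = there (multiplicity≢0⇒∈ xs (≢0 ∘ trans (cong (_+ multiplicity e xs) (δᵛ-≢ e≢v))))

multiplicity-∉ : ∀ {k} {e : Vec ℕ k} {xs} → All (e ≢_) xs → multiplicity e xs ≡ 0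
multiplicity-∉ []           = refl
multiplicity-∉ (e≢v ∷ e∉xs) = cong₂ _+_ (δᵛ-≢ e≢v) (multiplicity-∉ e∉xs)

↭-from-multiplicity : ∀ {k} (xs ys : List (Vec ℕ k)) →
                      (∀ e → multiplicity e xs ≡ multiplicity e ys) → xs ↭ ys
↭-from-multiplicity []       []       same = ↭-refl
↭-from-multiplicity []       (v ∷ ys) same with trans (same v) (multiplicity-∷-self v ys)
... | ()
↭-from-multiplicity (v ∷ xs) ys       same
  with ∈P.∈-∃++ (multiplicity≢0⇒∈ {e = v} ys
                  (NP.1+n≢0 ∘ trans (sym (multiplicity-∷-self v xs)) ∘ trans (same v)))
... | as , bs , refl =
  ↭-trans (↭-prep v (↭-from-multiplicity xs (as ++ bs) same′)) (↭-sym (↭P.shift v as bs))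
  where
  same′ : ∀ e → multiplicity e xs ≡ multiplicity e (as ++ bs)
  same′ e = NP.+-cancelˡ-≡ (δᵛ e v) _ _ (trans (same e) (multiplicity-↭ e (↭P.shift v as bs)))

multiplicities-differ : ∀ {k} {xs ys : List (Vec ℕ k)} → ¬ (xs ↭ ys) →
                        ∃ λ e → multiplicity e xs ≢ multiplicity e ys
multiplicities-differ {xs = xs} {ys} xs≁ys
  with Any.any? (λ e → ¬? (multiplicity e xs ℕ.≟ multiplicity e ys)) (xs ++ ys)
... | yes differing = Any.satisfied differing
... | no  none      = ⊥-elim (xs≁ys (↭-from-multiplicity xs ys same))
  where
  same : ∀ e → multiplicity e xs ≡ multiplicity e ys
  same e with multiplicity e xs ℕ.≟ multiplicity e ys
  ... | yes e-same  = e-same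
  ... | no  e-differ = ⊥-elim (none (Any.map (λ { refl → e-differ }) occurs))
    where
    occurs : e ∈ xs ++ ys
    occurs with multiplicity e xs ℕ.≟ 0
    ... | no  ∈xs = ∈P.∈-++⁺ˡ (multiplicity≢0⇒∈ xs ∈xs)
    ... | yes ∉xs = ∈P.∈-++⁺ʳ xs (multiplicity≢0⇒∈ ys (e-differ ∘ trans ∉xs ∘ sym))

↭-map⁻ : ∀ {k} (f : Vec ℕ k → ℕ) → (∀ {u v} → f u ≡ f v → u ≡ v) →
         ∀ {xs ys} → map f xs ↭ map f ys → xs ↭ ys
↭-map⁻ f f-inj {xs} {ys} fxs↭fys = ↭-from-multiplicity xs ys λ e → begin
  multiplicity e xs                  ≡⟨ count e xs ⟨
  sum (map (δ (f e)) (map f xs))     ≡⟨ NLP.sum-↭ (↭P.map⁺ (δ (f e)) fxs↭fys) ⟩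
  sum (map (δ (f e)) (map f ys))     ≡⟨ count e ys ⟩
  multiplicity e ys                  ∎
  where
  count : ∀ e zs → sum (map (δ (f e)) (map f zs)) ≡ multiplicity e zs
  count e zs = trans (cong sum (sym (ListP.map-∘ zs)))
                     (cong sum (ListP.map-cong (δ-injective f f-inj e) zs))

-- The exponent box {0,…,d}^k

InBox : ∀ {k} → ℕ → Vec ℕ k → Set
InBox d = VecAll.All (_≤ d)

inBox-mono : ∀ {k d d′} {v : Vec ℕ k} → d ≤ d′ → InBox d v → InBox d′ v
inBox-mono d≤d′ = VecAll.map (λ i≤d → NP.≤-trans i≤d d≤d′)

inBox-sum : ∀ {k} (v : Vec ℕ k) → InBox (Vec.sum v) v
inBox-sum []      = []
inBox-sum (n ∷ v) = NP.m≤m+n n _ ∷ inBox-mono (NP.m≤n+m _ n) (inBox-sum v)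

inBox-bound : ∀ {k} (xs : List (Vec ℕ k)) → All (InBox (sum (map Vec.sum xs))) xs
inBox-bound []       = []
inBox-bound (v ∷ xs) = inBox-mono (NP.m≤m+n _ _) (inBox-sum v)
                     ∷ All.map (inBox-mono (NP.m≤n+m _ (Vec.sum v))) (inBox-bound xs)

box-inBox : ∀ k d → All (InBox d) (box k d)
box-inBox zero    d = [] ∷ []
box-inBox (suc k) d = AllP.concat⁺ (AllP.map⁺ (AllP.applyUpTo⁺₁ id (suc d) λ i<1+d →
  AllP.map⁺ (All.map (NP.≤-pred i<1+d ∷_) (box-inBox k d))))

sum-applyUpTo-δ : ∀ n (H : ℕ → ℕ) {x} → x < n → sum (applyUpTo (λ i → δ i x * H i) n) ≡ H x
sum-applyUpTo-δ (suc n) H {zero}  _         = begin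
  1 * H 0 + sum (applyUpTo (λ _ → 0) n) ≡⟨ cong₂ _+_ (NP.*-identityˡ (H 0)) (sum-zero n) ⟩
  H 0 + 0                                ≡⟨ NP.+-identityʳ (H 0) ⟩
  H 0                                    ∎
  where
  sum-zero : ∀ n → sum (applyUpTo (λ _ → 0) n) ≡ 0
  sum-zero zero    = refl
  sum-zero (suc n) = sum-zero n
sum-applyUpTo-δ (suc n) H {suc x} (s≤s x<n) = sum-applyUpTo-δ n (H ∘ suc) x<n

sum-box-δᵛ : ∀ {k} d (G : Vec ℕ k → ℕ) {v} → InBox d v →
             sum (map (λ e → δᵛ e v * G e) (box k d)) ≡ G v
sum-box-δᵛ {zero}  d G []                = trans (NP.+-identityʳ _) (NP.+-identityʳ (G []))
sum-box-δᵛ {suc k} d G {n ∷ v} (n≤d ∷ v∈box) = begin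
  sum (map F (concatMap (λ i → map (i ∷_) (box k d)) (upTo (suc d))))
    ≡⟨ sum-map-concatMap F (λ i → map (i ∷_) (box k d)) (upTo (suc d)) ⟩
  sum (map (λ i → sum (map F (map (i ∷_) (box k d)))) (upTo (suc d)))
    ≡⟨ cong sum (ListP.map-cong slice (upTo (suc d))) ⟩
  sum (map (λ i → δ i n * G (i ∷ v)) (upTo (suc d)))
    ≡⟨ cong sum (ListP.map-upTo _ (suc d)) ⟩
  sum (applyUpTo (λ i → δ i n * G (i ∷ v)) (suc d))
    ≡⟨ sum-applyUpTo-δ (suc d) (λ i → G (i ∷ v)) (s≤s n≤d) ⟩
  G (n ∷ v) ∎
  where
  F : Vec ℕ (suc k) → ℕ
  F e = δᵛ e (n ∷ v) * G e
  slice : ∀ i → sum (map F (map (i ∷_) (box k d))) ≡ δ i n * G (i ∷ v)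
  slice i = begin
    sum (map F (map (i ∷_) (box k d)))
      ≡⟨ cong sum (ListP.map-∘ (box k d)) ⟨
    sum (map (λ e → δ i n * δᵛ e v * G (i ∷ e)) (box k d))
      ≡⟨ cong sum (ListP.map-cong (λ e → NP.*-assoc (δ i n) (δᵛ e v) (G (i ∷ e))) (box k d)) ⟩
    sum (map (λ e → δ i n * (δᵛ e v * G (i ∷ e))) (box k d))
      ≡⟨ sum-map-*ˡ (δ i n) _ (box k d) ⟩
    δ i n * sum (map (λ e → δᵛ e v * G (i ∷ e)) (box k d))
      ≡⟨ cong (δ i n *_) (sum-box-δᵛ d (λ e → G (i ∷ e)) v∈box) ⟩
    δ i n * G (i ∷ v) ∎

sum-box-multiplicity : ∀ {k} d (G : Vec ℕ k → ℕ) {xs} → All (InBox d) xs →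
                       sum (map (λ e → multiplicity e xs * G e) (box k d)) ≡ sum (map G xs)
sum-box-multiplicity {k} d G []                    = sum-map-zero _ (λ _ → refl) (box k d)
sum-box-multiplicity {k} d G {v ∷ xs} (v∈box ∷ xs∈box) = begin
  sum (map (λ e → (δᵛ e v + multiplicity e xs) * G e) (box k d))
    ≡⟨ cong sum (ListP.map-cong (λ e → NP.*-distribʳ-+ (G e) (δᵛ e v) _) (box k d)) ⟩
  sum (map (λ e → δᵛ e v * G e + multiplicity e xs * G e) (box k d))
    ≡⟨ sum-map-+ _ _ (box k d) ⟩
  sum (map (λ e → δᵛ e v * G e) (box k d)) + sum (map (λ e → multiplicity e xs * G e) (box k d))
    ≡⟨ cong₂ _+_ (sum-box-δᵛ d G v∈box) (sum-box-multiplicity d G xs∈box) ⟩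
  G v + sum (map G xs) ∎

withMultiplicity : ∀ {k} → ℕ → (Vec ℕ k → ℕ) → List (Vec ℕ k)
withMultiplicity {k} d m = concatMap (λ v → List.replicate (m v) v) (box k d)

multiplicity-withMultiplicity : ∀ {k} d (m : Vec ℕ k → ℕ) → (∀ e → ¬ InBox d e → m e ≡ 0) →
                                ∀ e → multiplicity e (withMultiplicity d m) ≡ m e
multiplicity-withMultiplicity {k} d m m-supported e = begin
  multiplicity e (withMultiplicity d m)
    ≡⟨ sum-map-concatMap (δᵛ e) (λ v → List.replicate (m v) v) (box k d) ⟩
  sum (map (λ v → sum (map (δᵛ e) (List.replicate (m v) v))) (box k d))
    ≡⟨ cong sum (ListP.map-cong copies (box k d)) ⟩
  sum (map (λ v → δᵛ v e * m v) (box k d))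
    ≡⟨ picked ⟩
  m e ∎
  where
  copies : ∀ v → sum (map (δᵛ e) (List.replicate (m v) v)) ≡ δᵛ v e * m v
  copies v = trans (sum-map-replicate (δᵛ e) (m v) v)
                   (trans (NP.*-comm (m v) _) (cong (_* m v) (δᵛ-sym e v)))
  picked : sum (map (λ v → δᵛ v e * m v) (box k d)) ≡ m e
  picked with VecAll.all? (ℕ._≤? d) e
  ... | yes e∈box = sum-box-δᵛ d m e∈box
  ... | no  e∉box = trans (sum-map-zero _ vanish (box k d)) (sym (m-supported e e∉box))
    where
    vanish : ∀ v → δᵛ v e * m v ≡ 0
    vanish v with VecAll.all? (ℕ._≤? d) v
    ... | yes v∈box = cong (_* m v) (δᵛ-≢ {u = v} λ { refl → e∉box v∈box })
    ... | no  v∉box = trans (cong (δᵛ v e *_) (m-supported v v∉box)) (NP.*-zeroʳ (δᵛ v e))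

withMultiplicity-inBox : ∀ {k} d (m : Vec ℕ k → ℕ) → All (InBox d) (withMultiplicity d m)
withMultiplicity-inBox {k} d m =
  AllP.concat⁺ (AllP.map⁺ (All.map (λ {v} v∈box → AllP.replicate⁺ (m v) v∈box) (box-inBox k d)))

-- ∂ℓ z^v = v_ℓ z^(v - e_ℓ).  lower ℓ v is the (at most one) exponent of ∂ℓ z^v, and the
-- coefficient v_ℓ is recovered from it as 1 + (its ℓ-th entry).

lower : ∀ {k} → Fin k → Vec ℕ k → List (Vec ℕ k)
lower zero    (zero  ∷ v) = []
lower zero    (suc n ∷ v) = (n ∷ v) ∷ []
lower (suc ℓ) (n ∷ v)     = map (n ∷_) (lower ℓ v)

lowerAll : ∀ {k} → Fin k → List (Vec ℕ k) → List (Vec ℕ k)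
lowerAll ℓ = concatMap (lower ℓ)

exponentSum : ∀ {k} → Fin k → List (Vec ℕ k) → ℕ
exponentSum ℓ xs = sum (map (λ v → lookup v ℓ) xs)

δᵛ-raise : ∀ {k} (ℓ : Fin k) e v → δᵛ (Vec.updateAt e ℓ suc) v ≡ multiplicity e (lower ℓ v)
δᵛ-raise zero    (m ∷ e) (zero  ∷ v) = refl
δᵛ-raise zero    (m ∷ e) (suc n ∷ v) = sym (NP.+-identityʳ _)
δᵛ-raise (suc ℓ) (m ∷ e) (n ∷ v)     = begin
  δ m n * δᵛ (Vec.updateAt e ℓ suc) v     ≡⟨ cong (δ m n *_) (δᵛ-raise ℓ e v) ⟩
  δ m n * multiplicity e (lower ℓ v)      ≡⟨ multiplicity-map-∷ m n e (lower ℓ v) ⟨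
  multiplicity (m ∷ e) (lower (suc ℓ) (n ∷ v)) ∎

multiplicity-raise : ∀ {k} (ℓ : Fin k) e xs →
                     multiplicity (Vec.updateAt e ℓ suc) xs ≡ multiplicity e (lowerAll ℓ xs)
multiplicity-raise ℓ e xs = begin
  multiplicity (Vec.updateAt e ℓ suc) xs                     ≡⟨ cong sum (ListP.map-cong (δᵛ-raise ℓ e) xs) ⟩
  sum (map (λ v → multiplicity e (lower ℓ v)) xs)            ≡⟨ sum-map-concatMap (δᵛ e) (lower ℓ) xs ⟨
  multiplicity e (lowerAll ℓ xs)                             ∎

sum-lower : ∀ {k} (ℓ : Fin k) v → sum (map (λ w → suc (lookup w ℓ)) (lower ℓ v)) ≡ lookup v ℓ
sum-lower zero    (zero  ∷ v) = refl
sum-lower zero    (suc n ∷ v) = NP.+-identityʳ (suc n)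
sum-lower (suc ℓ) (n ∷ v)     = trans (cong sum (sym (ListP.map-∘ (lower ℓ v)))) (sum-lower ℓ v)

lower-inBox : ∀ {k d} (ℓ : Fin k) {v} → InBox d v → All (InBox d) (lower ℓ v)
lower-inBox zero    {zero  ∷ v} _             = []
lower-inBox zero    {suc n ∷ v} (n<d ∷ v∈box) = (NP.≤-trans (NP.n≤1+n n) n<d ∷ v∈box) ∷ []
lower-inBox (suc ℓ) {n ∷ v}     (n≤d ∷ v∈box) = AllP.map⁺ (All.map (n≤d ∷_) (lower-inBox ℓ v∈box))

sum-box-multiplicity-lowerAll : ∀ {k} d (ℓ : Fin k) {xs} → All (InBox d) xs →
  sum (map (λ e → multiplicity e (lowerAll ℓ xs) * suc (lookup e ℓ)) (box k d)) ≡ exponentSum ℓ xs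
sum-box-multiplicity-lowerAll d ℓ {xs} xs∈box = begin
  sum (map (λ e → multiplicity e (lowerAll ℓ xs) * suc (lookup e ℓ)) (box _ d))
    ≡⟨ sum-box-multiplicity d _ (AllP.concat⁺ (AllP.map⁺ (All.map (lower-inBox ℓ) xs∈box))) ⟩
  sum (map (λ w → suc (lookup w ℓ)) (lowerAll ℓ xs))
    ≡⟨ sum-map-concatMap _ (lower ℓ) xs ⟩
  sum (map (λ v → sum (map (λ w → suc (lookup w ℓ)) (lower ℓ v))) xs)
    ≡⟨ cong sum (ListP.map-cong (sum-lower ℓ) xs) ⟩
  exponentSum ℓ xs ∎

⊖-+-⊖ : ∀ a b c d → (a ⊖ b) ℤ.+ (c ⊖ d) ≡ (a + c) ⊖ (b + d)
⊖-+-⊖ a b c d = begin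
  (a ⊖ b) ℤ.+ (c ⊖ d)                     ≡⟨ cong₂ ℤ._+_ (ZP.[+m]-[+n]≡m⊖n a b) (ZP.[+m]-[+n]≡m⊖n c d) ⟨
  (+ a ℤ.- + b) ℤ.+ (+ c ℤ.- + d)         ≡⟨ regroup (+ a) (+ b) (+ c) (+ d) ⟩
  (+ a ℤ.+ + c) ℤ.- (+ b ℤ.+ + d)         ≡⟨ cong₂ ℤ._-_ (ZP.pos-+ a c) (ZP.pos-+ b d) ⟨
  + (a + c) ℤ.- + (b + d)                 ≡⟨ ZP.[+m]-[+n]≡m⊖n (a + c) (b + d) ⟩
  (a + c) ⊖ (b + d)                       ∎
  where
  regroup : ∀ (w x y z : ℤ) → (w ℤ.- x) ℤ.+ (y ℤ.- z) ≡ (w ℤ.+ y) ℤ.- (x ℤ.+ z)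
  regroup = solve-∀

⊖-*-+ : ∀ a b c → (a ⊖ b) ℤ.* + c ≡ (a * c) ⊖ (b * c)
⊖-*-+ a b c = begin
  (a ⊖ b) ℤ.* + c                     ≡⟨ cong (ℤ._* + c) (ZP.[+m]-[+n]≡m⊖n a b) ⟨
  (+ a ℤ.- + b) ℤ.* + c               ≡⟨ distrib (+ a) (+ b) (+ c) ⟩
  + a ℤ.* + c ℤ.- + b ℤ.* + c         ≡⟨ cong₂ ℤ._-_ (ZP.pos-* a c) (ZP.pos-* b c) ⟨
  + (a * c) ℤ.- + (b * c)             ≡⟨ ZP.[+m]-[+n]≡m⊖n (a * c) (b * c) ⟩
  (a * c) ⊖ (b * c)                   ∎
  where
  distrib : ∀ (x y z : ℤ) → (x ℤ.- y) ℤ.* z ≡ x ℤ.* z ℤ.- y ℤ.* z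
  distrib = solve-∀

⊖≡0⇒≡ : ∀ {a b} → a ⊖ b ≡ + 0 → a ≡ b
⊖≡0⇒≡ {a} {b} a⊖b≡0 = cong ∣_∣ (ZP.i-j≡0⇒i≡j (+ a) (+ b) (trans (ZP.[+m]-[+n]≡m⊖n a b) a⊖b≡0))

≡⇒⊖≡0 : ∀ {a b} → a ≡ b → a ⊖ b ≡ + 0
≡⇒⊖≡0 {a} refl = ZP.n⊖n≡0 a

∣⊖∣≤+ : ∀ a b → ∣ a ⊖ b ∣ ≤ a + b
∣⊖∣≤+ a b with NP.≤-total a b
... | inj₁ a≤b = subst (_≤ a + b) (sym (ZP.∣⊖∣-≤ a≤b)) (NP.≤-trans (NP.m∸n≤m b a) (NP.m≤n+m b a))
... | inj₂ b≤a = subst (_≤ a + b) (sym (trans (ZP.∣m⊖n∣≡∣n⊖m∣ a b) (ZP.∣⊖∣-≤ b≤a)))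
                       (NP.≤-trans (NP.m∸n≤m a b) (NP.m≤m+n a b))

∣⊖∣≡+ : ∀ {a b} → a ≡ 0 ⊎ b ≡ 0 → ∣ a ⊖ b ∣ ≡ a + b
∣⊖∣≡+ {b = zero}  (inj₁ refl) = refl
∣⊖∣≡+ {b = suc b} (inj₁ refl) = refl
∣⊖∣≡+ {zero}      (inj₂ refl) = refl
∣⊖∣≡+ {suc a}     (inj₂ refl) = sym (NP.+-identityʳ (suc a))

sumℤ-map-⊖ : {A : Set} (f g : A → ℕ) (xs : List A) →
             sumℤ (map (λ x → f x ⊖ g x) xs) ≡ sum (map f xs) ⊖ sum (map g xs)
sumℤ-map-⊖ f g []       = refl
sumℤ-map-⊖ f g (x ∷ xs) = trans (cong (ℤ._+_ (f x ⊖ g x)) (sumℤ-map-⊖ f g xs)) (⊖-+-⊖ (f x) (g x) _ _)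

positivePart negativePart : ℤ → ℕ
positivePart (+ n)    = n
positivePart -[1+ n ] = 0
negativePart (+ n)    = 0
negativePart -[1+ n ] = suc n

positivePart⊖negativePart : ∀ z → positivePart z ⊖ negativePart z ≡ z
positivePart⊖negativePart (+ n)    = refl
positivePart⊖negativePart -[1+ n ] = refl

positivePart≡0⊎negativePart≡0 : ∀ z → positivePart z ≡ 0 ⊎ negativePart z ≡ 0
positivePart≡0⊎negativePart≡0 (+ n)    = inj₂ refl
positivePart≡0⊎negativePart≡0 -[1+ n ] = inj₁ refl

-- Polynomials whose coefficients are differences of multiplicities

monomial-ones : ∀ {k} (e : Vec ℕ k) → monomial (ones k) e ≡ + 1
monomial-ones []      = refl
monomial-ones (n ∷ e) = cong₂ ℤ._*_ (ZP.^-zeroˡ n) (monomial-ones e)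

pos-^ : ∀ m n → (+ m) ℤ.^ n ≡ + (m ^ n)
pos-^ m zero    = refl
pos-^ m (suc n) = trans (cong (+ m ℤ.*_) (pos-^ m n)) (sym (ZP.pos-* m (m ^ n)))

monomial-toℤ : ∀ {k} (q e : Vec ℕ k) → monomial (toℤ q) e ≡ + prodPow q e
monomial-toℤ []      []      = refl
monomial-toℤ (m ∷ q) (n ∷ e) =
  trans (cong₂ ℤ._*_ (pos-^ m n) (monomial-toℤ q e)) (sym (ZP.pos-* (m ^ n) (prodPow q e)))

module DifferencePolynomial {k} (d : ℕ) {xs ys : List (Vec ℕ k)}
  (xs∈box : All (InBox d) xs) (ys∈box : All (InBox d) ys)
  (χ : Coeffs k) (χ-coeff : ∀ e → χ e ≡ multiplicity e xs ⊖ multiplicity e ys) where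

  eval-⊖ : (x : Vec ℤ k) (G : Vec ℕ k → ℕ) → (∀ e → monomial x e ≡ + G e) →
           eval d χ x ≡ sum (map G xs) ⊖ sum (map G ys)
  eval-⊖ x G monomial≡G = begin
    eval d χ x
      ≡⟨ cong sumℤ (ListP.map-cong term (box k d)) ⟩
    sumℤ (map (λ e → (multiplicity e xs * G e) ⊖ (multiplicity e ys * G e)) (box k d))
      ≡⟨ sumℤ-map-⊖ _ _ (box k d) ⟩
    sum (map (λ e → multiplicity e xs * G e) (box k d))
      ⊖ sum (map (λ e → multiplicity e ys * G e) (box k d))
      ≡⟨ cong₂ _⊖_ (sum-box-multiplicity d G xs∈box) (sum-box-multiplicity d G ys∈box) ⟩
    sum (map G xs) ⊖ sum (map G ys) ∎
    where
    term : ∀ e → χ e ℤ.* monomial x e ≡ (multiplicity e xs * G e) ⊖ (multiplicity e ys * G e)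
    term e = trans (cong₂ ℤ._*_ (χ-coeff e) (monomial≡G e))
                   (⊖-*-+ (multiplicity e xs) (multiplicity e ys) (G e))

  module _ (ℓ : Fin k) where

    private
      c mx my : Vec ℕ k → ℕ
      c  e = suc (lookup e ℓ)
      mx e = multiplicity e (lowerAll ℓ xs)
      my e = multiplicity e (lowerAll ℓ ys)

    partial-coeff : ∀ e → partial ℓ χ e ≡ + c e ℤ.* (mx e ⊖ my e)
    partial-coeff e = cong (+ c e ℤ.*_)
      (trans (χ-coeff _) (cong₂ _⊖_ (multiplicity-raise ℓ e xs) (multiplicity-raise ℓ e ys)))

    eval-partial-ones : eval d (partial ℓ χ) (ones k) ≡ exponentSum ℓ xs ⊖ exponentSum ℓ ys
    eval-partial-ones = begin
      eval d (partial ℓ χ) (ones k)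
        ≡⟨ cong sumℤ (ListP.map-cong term (box k d)) ⟩
      sumℤ (map (λ e → (mx e * c e) ⊖ (my e * c e)) (box k d))
        ≡⟨ sumℤ-map-⊖ _ _ (box k d) ⟩
      sum (map (λ e → mx e * c e) (box k d)) ⊖ sum (map (λ e → my e * c e) (box k d))
        ≡⟨ cong₂ _⊖_ (sum-box-multiplicity-lowerAll d ℓ xs∈box) (sum-box-multiplicity-lowerAll d ℓ ys∈box) ⟩
      exponentSum ℓ xs ⊖ exponentSum ℓ ys ∎
      where
      term : ∀ e → partial ℓ χ e ℤ.* monomial (ones k) e ≡ (mx e * c e) ⊖ (my e * c e)
      term e = begin
        partial ℓ χ e ℤ.* monomial (ones k) e ≡⟨ cong₂ ℤ._*_ (partial-coeff e) (monomial-ones e) ⟩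
        + c e ℤ.* (mx e ⊖ my e) ℤ.* + 1       ≡⟨ ZP.*-identityʳ _ ⟩
        + c e ℤ.* (mx e ⊖ my e)               ≡⟨ ZP.*-comm (+ c e) _ ⟩
        (mx e ⊖ my e) ℤ.* + c e               ≡⟨ ⊖-*-+ (mx e) (my e) (c e) ⟩
        (mx e * c e) ⊖ (my e * c e)           ∎

    private
      ∣partial∣ : ∀ e → ∣ partial ℓ χ e ∣ ≡ c e * ∣ mx e ⊖ my e ∣
      ∣partial∣ e = trans (cong ∣_∣ (partial-coeff e)) (ZP.abs-* (+ c e) (mx e ⊖ my e))

      sum-both : sum (map (λ e → c e * (mx e + my e)) (box k d)) ≡ exponentSum ℓ xs + exponentSum ℓ ys
      sum-both = begin
        sum (map (λ e → c e * (mx e + my e)) (box k d))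
          ≡⟨ cong sum (ListP.map-cong distrib (box k d)) ⟩
        sum (map (λ e → mx e * c e + my e * c e) (box k d))
          ≡⟨ sum-map-+ _ _ (box k d) ⟩
        sum (map (λ e → mx e * c e) (box k d)) + sum (map (λ e → my e * c e) (box k d))
          ≡⟨ cong₂ _+_ (sum-box-multiplicity-lowerAll d ℓ xs∈box) (sum-box-multiplicity-lowerAll d ℓ ys∈box) ⟩
        exponentSum ℓ xs + exponentSum ℓ ys ∎
        where
        distrib : ∀ e → c e * (mx e + my e) ≡ mx e * c e + my e * c e
        distrib e = trans (NP.*-comm (c e) _) (NP.*-distribʳ-+ (c e) (mx e) (my e))

    absCoeffSum-partial-≤ : absCoeffSum d (partial ℓ χ) ≤ exponentSum ℓ xs + exponentSum ℓ ys
    absCoeffSum-partial-≤ =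
      NP.≤-trans (NP.≤-reflexive (cong sum (ListP.map-cong ∣partial∣ (box k d))))
     (NP.≤-trans (sum-map-mono (λ e → NP.*-monoʳ-≤ (c e) (∣⊖∣≤+ (mx e) (my e))) (box k d))
                 (NP.≤-reflexive sum-both))

    absCoeffSum-partial-≡ : (∀ e → multiplicity e xs ≡ 0 ⊎ multiplicity e ys ≡ 0) →
                            absCoeffSum d (partial ℓ χ) ≡ exponentSum ℓ xs + exponentSum ℓ ys
    absCoeffSum-partial-≡ disjoint = trans (cong sum (ListP.map-cong term (box k d))) sum-both
      where
      term : ∀ e → ∣ partial ℓ χ e ∣ ≡ c e * (mx e + my e)
      term e = trans (∣partial∣ e) (cong (c e *_) (∣⊖∣≡+ lowered-disjoint))
        where
        lowered-disjoint : mx e ≡ 0 ⊎ my e ≡ 0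
        lowered-disjoint with disjoint (Vec.updateAt e ℓ suc)
        ... | inj₁ x≡0 = inj₁ (trans (sym (multiplicity-raise ℓ e xs)) x≡0)
        ... | inj₂ y≡0 = inj₂ (trans (sym (multiplicity-raise ℓ e ys)) y≡0)

-- Products of prime powers

vecSum : ∀ {k} → List (Vec ℕ k) → Vec ℕ k
vecSum {k} = List.foldr (zipWith _+_) (replicate k 0)

lookup-vecSum : ∀ {k} (ℓ : Fin k) xs → lookup (vecSum xs) ℓ ≡ exponentSum ℓ xs
lookup-vecSum ℓ []       = VecP.lookup-replicate ℓ 0
lookup-vecSum ℓ (v ∷ xs) =
  trans (VecP.lookup-zipWith _+_ ℓ v (vecSum xs)) (cong (_+_ (lookup v ℓ)) (lookup-vecSum ℓ xs))

vecSum-≡ : ∀ {k} {xs ys : List (Vec ℕ k)} → (∀ ℓ → exponentSum ℓ xs ≡ exponentSum ℓ ys) →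
           vecSum xs ≡ vecSum ys
vecSum-≡ {xs = xs} {ys} same = begin
  vecSum xs                          ≡⟨ VecP.tabulate∘lookup (vecSum xs) ⟨
  Vec.tabulate (lookup (vecSum xs))  ≡⟨ VecP.tabulate-cong coordinatewise ⟩
  Vec.tabulate (lookup (vecSum ys))  ≡⟨ VecP.tabulate∘lookup (vecSum ys) ⟩
  vecSum ys                          ∎
  where
  coordinatewise : ∀ ℓ → lookup (vecSum xs) ℓ ≡ lookup (vecSum ys) ℓ
  coordinatewise ℓ = trans (lookup-vecSum ℓ xs) (trans (same ℓ) (sym (lookup-vecSum ℓ ys)))

prodPow-+ : ∀ {k} (q a b : Vec ℕ k) → prodPow q (zipWith _+_ a b) ≡ prodPow q a * prodPow q b
prodPow-+ []      []      []      = refl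
prodPow-+ (m ∷ q) (a ∷ as) (b ∷ bs) = begin
  m ^ (a + b) * prodPow q (zipWith _+_ as bs)       ≡⟨ cong₂ _*_ (NP.^-distribˡ-+-* m a b) (prodPow-+ q as bs) ⟩
  m ^ a * m ^ b * (prodPow q as * prodPow q bs)     ≡⟨ *-interchange (m ^ a) (m ^ b) _ _ ⟩
  m ^ a * prodPow q as * (m ^ b * prodPow q bs)     ∎

prodPow-zero : ∀ {k} (q : Vec ℕ k) → prodPow q (replicate k 0) ≡ 1
prodPow-zero []      = refl
prodPow-zero (m ∷ q) = cong (_+ 0) (prodPow-zero q)

product-map-prodPow : ∀ {k} (q : Vec ℕ k) xs → product (map (prodPow q) xs) ≡ prodPow q (vecSum xs)
product-map-prodPow q []       = sym (prodPow-zero q)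
product-map-prodPow q (v ∷ xs) =
  trans (cong (prodPow q v *_) (product-map-prodPow q xs)) (sym (prodPow-+ q v (vecSum xs)))

prodPow-positive : ∀ {k} (q : Vec ℕ k) → (∀ i → NonZero (lookup q i)) → ∀ e → 1 ≤ prodPow q e
prodPow-positive []      q≢0 []      = s≤s z≤n
prodPow-positive (m ∷ q) q≢0 (n ∷ e) =
  NP.*-mono-≤ (NP.m^n>0 m {{q≢0 zero}} n) (prodPow-positive q (q≢0 ∘ suc) e)

prodPow-∸-* : ∀ {k} (q j t : Vec ℕ k) → (∀ i → lookup t i ≤ lookup j i) →
              prodPow q (zipWith _∸_ j t) * prodPow q t ≡ prodPow q j
prodPow-∸-* q j t t≤j = trans (sym (prodPow-+ q (zipWith _∸_ j t) t)) (cong (prodPow q) (∸-+ j t t≤j))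
  where
  ∸-+ : ∀ {k} (j t : Vec ℕ k) → (∀ i → lookup t i ≤ lookup j i) → zipWith _+_ (zipWith _∸_ j t) t ≡ j
  ∸-+ []      []      _   = refl
  ∸-+ (a ∷ j) (b ∷ t) t≤j = cong₂ _∷_ (NP.m∸n+n≡m (t≤j zero)) (∸-+ j t (t≤j ∘ suc))

prime≢1 : ∀ {p} → Prime p → p ≢ 1
prime≢1 p-prime = ℕ.nonTrivial⇒≢1 {{prime⇒nonTrivial p-prime}}

prime∣prime⇒≡ : ∀ {p r} → Prime p → Prime r → p ∣ r → p ≡ r
prime∣prime⇒≡ p-prime r-prime p∣r with prime⇒irreducible r-prime p∣r
... | inj₁ p≡1 = ⊥-elim (prime≢1 p-prime p≡1)
... | inj₂ p≡r = p≡r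

prime∤1 : ∀ {p} → Prime p → ¬ (p ∣ 1)
prime∤1 p-prime = prime≢1 p-prime ∘ ∣1⇒≡1

prime∣^⇒∣ : ∀ {p} m n → Prime p → p ∣ m ^ n → p ∣ m
prime∣^⇒∣ m zero    p-prime p∣1 = ⊥-elim (prime∤1 p-prime p∣1)
prime∣^⇒∣ m (suc n) p-prime p∣m^1+n with euclidsLemma m (m ^ n) p-prime p∣m^1+n
... | inj₁ p∣m   = p∣m
... | inj₂ p∣m^n = prime∣^⇒∣ m n p-prime p∣m^n

prime∣prodPow⇒≡ : ∀ {k p} (q e : Vec ℕ k) → Prime p → (∀ i → Prime (lookup q i)) →
                  p ∣ prodPow q e → ∃ λ i → p ≡ lookup q i
prime∣prodPow⇒≡ []      []      p-prime prime p∣1 = ⊥-elim (prime∤1 p-prime p∣1)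
prime∣prodPow⇒≡ (m ∷ q) (n ∷ e) p-prime prime p∣ with euclidsLemma (m ^ n) (prodPow q e) p-prime p∣
... | inj₁ p∣m^n = zero , prime∣prime⇒≡ p-prime (prime zero) (prime∣^⇒∣ m n p-prime p∣m^n)
... | inj₂ p∣q^e with prime∣prodPow⇒≡ q e p-prime (prime ∘ suc) p∣q^e
...   | i , p≡qᵢ = suc i , p≡qᵢ

p^a*m≡p^b*n⇒a≡b∧m≡n : ∀ p .{{_ : NonZero p}} a b {m n} → ¬ (p ∣ m) → ¬ (p ∣ n) →
                      p ^ a * m ≡ p ^ b * n → a ≡ b × m ≡ n
p^a*m≡p^b*n⇒a≡b∧m≡n p zero    zero    {m} {n} _   _   eq =
  refl , trans (sym (NP.*-identityˡ m)) (trans eq (NP.*-identityˡ n))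
p^a*m≡p^b*n⇒a≡b∧m≡n p (suc a) (suc b) {m} {n} p∤m p∤n eq
  with p^a*m≡p^b*n⇒a≡b∧m≡n p a b p∤m p∤n (NP.*-cancelˡ-≡ (p ^ a * m) (p ^ b * n) p
         (trans (sym (NP.*-assoc p (p ^ a) m)) (trans eq (NP.*-assoc p (p ^ b) n))))
... | a≡b , m≡n = cong suc a≡b , m≡n
p^a*m≡p^b*n⇒a≡b∧m≡n p (suc a) zero    {m} {n} _   p∤n eq =
  ⊥-elim (p∤n (subst (p ∣_) (trans eq (NP.*-identityˡ n)) (∣-trans (m∣m*n (p ^ a)) (m∣m*n m))))
p^a*m≡p^b*n⇒a≡b∧m≡n p zero    (suc b) {m} {n} p∤m _   eq =
  ⊥-elim (p∤m (subst (p ∣_) (trans (sym eq) (NP.*-identityˡ m)) (∣-trans (m∣m*n (p ^ b)) (m∣m*n n))))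

prodPow-injective : ∀ {k} (q : Vec ℕ k) → (∀ i → Prime (lookup q i)) →
                    (∀ i i′ → lookup q i ≡ lookup q i′ → i ≡ i′) →
                    ∀ {a b} → prodPow q a ≡ prodPow q b → a ≡ b
prodPow-injective []      prime distinct {[]}     {[]}     _  = refl
prodPow-injective (m ∷ q) prime distinct {a ∷ as} {b ∷ bs} eq
  with p^a*m≡p^b*n⇒a≡b∧m≡n m {{prime⇒nonZero (prime zero)}} a b (m∤ as) (m∤ bs) eq
  where
  m∤ : ∀ e → ¬ (m ∣ prodPow q e)
  m∤ e m∣ with prime∣prodPow⇒≡ q e (prime zero) (prime ∘ suc) m∣
  ... | i , m≡qᵢ with distinct zero (suc i) m≡qᵢ
  ... | ()
... | a≡b , as≡bs = cong₂ _∷_ a≡b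
  (prodPow-injective q (prime ∘ suc) (λ i i′ → FinP.suc-injective ∘ distinct (suc i) (suc i′)) as≡bs)

∣p^j*n⇒p^t*d′ : ∀ {p} → Prime p → ∀ j n d → d ∣ p ^ j * n →
                ∃₂ λ t d′ → d ≡ p ^ t * d′ × d′ ∣ n
∣p^j*n⇒p^t*d′ {p} p-prime zero    n d d∣n =
  0 , d , sym (NP.*-identityˡ d) , subst (d ∣_) (NP.*-identityˡ n) d∣n
∣p^j*n⇒p^t*d′ {p} p-prime (suc j) n d d∣ with p ∣? d
... | yes (divides d₀ d≡d₀p)
  with ∣p^j*n⇒p^t*d′ p-prime j n d₀ (*-cancelˡ-∣ p {{prime⇒nonZero p-prime}}
         (subst₂ _∣_ (trans d≡d₀p (NP.*-comm d₀ p)) (NP.*-assoc p (p ^ j) n) d∣))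
...   | t , d′ , d₀≡ , d′∣n = suc t , d′ , d≡ , d′∣n
  where
  d≡ : d ≡ p ^ suc t * d′
  d≡ = begin
    d                ≡⟨ d≡d₀p ⟩
    d₀ * p           ≡⟨ NP.*-comm d₀ p ⟩
    p * d₀           ≡⟨ cong (p *_) d₀≡ ⟩
    p * (p ^ t * d′) ≡⟨ NP.*-assoc p (p ^ t) d′ ⟨
    p ^ suc t * d′   ∎
∣p^j*n⇒p^t*d′ {p} p-prime (suc j) n d d∣ | no p∤d =
  ∣p^j*n⇒p^t*d′ p-prime j n d (coprime-divisor d⊥p (subst (d ∣_) (NP.*-assoc p (p ^ j) n) d∣))
  where
  d⊥p : Coprime d p
  d⊥p (c∣d , c∣p) with prime⇒irreducible p-prime c∣p
  ... | inj₁ c≡1 = c≡1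
  ... | inj₂ refl = ⊥-elim (p∤d c∣d)

∣prodPow⇒≡prodPow : ∀ {k} (q j : Vec ℕ k) → (∀ i → Prime (lookup q i)) →
                    ∀ {d} → d ∣ prodPow q j → ∃ λ e → d ≡ prodPow q e
∣prodPow⇒≡prodPow []      []      prime d∣1 = [] , ∣1⇒≡1 d∣1
∣prodPow⇒≡prodPow (m ∷ q) (a ∷ j) prime d∣ with ∣p^j*n⇒p^t*d′ (prime zero) a (prodPow q j) _ d∣
... | t , d′ , d≡ , d′∣ with ∣prodPow⇒≡prodPow q j (prime ∘ suc) d′∣
...   | e , d′≡ = t ∷ e , trans d≡ (cong (m ^ t *_) d′≡)

product∣prodPow⇒map-prodPow : ∀ {k} (q j : Vec ℕ k) → (∀ i → Prime (lookup q i)) →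
  ∀ xs → product xs ∣ prodPow q j → ∃ λ es → map (prodPow q) es ≡ xs
product∣prodPow⇒map-prodPow q j prime []       _  = [] , refl
product∣prodPow⇒map-prodPow q j prime (x ∷ xs) x*xs∣
  with ∣prodPow⇒≡prodPow q j prime (∣-trans (m∣m*n (product xs)) x*xs∣)
     | product∣prodPow⇒map-prodPow q j prime xs (∣-trans (n∣m*n x) x*xs∣)
... | e , x≡ | es , es≡ = e ∷ es , cong₂ _∷_ (sym x≡) es≡

-- Both sides of the equivalence reduce to the existence of such a pair of multisets of
-- exponent vectors.

record ExponentCollision {k} (q j : Vec ℕ k) : Set where
  field
    xs ys        : List (Vec ℕ k)
    sum≡         : sum (map (prodPow q) xs) ≡ sum (map (prodPow q) ys)
    length≡      : length xs ≡ length ys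
    exponentSum≡ : ∀ ℓ → exponentSum ℓ xs ≡ exponentSum ℓ ys
    exponentSum≤ : ∀ ℓ → exponentSum ℓ xs ≤ lookup j ℓ
    xs≁ys        : ¬ (xs ↭ ys)

WitnessPolynomial : ∀ {k} → Vec ℕ k → Vec ℕ k → Set
WitnessPolynomial {k} q j = Σ ℕ λ d → Σ (Coeffs k) λ χ →
  SupportedIn d χ × NonzeroPoly χ ×
  eval d χ (toℤ q) ≡ + 0 ×
  (∀ (ℓ : Fin k) → eval d (partial ℓ χ) (ones k) ≡ + 0) ×
  (∀ (ℓ : Fin k) → absCoeffSum d (partial ℓ χ) ≤ 2 * lookup j ℓ) ×
  eval d χ (ones k) ≡ + 0

admissible⇒collision : ∀ {k} (q j : Vec ℕ k) → (∀ i → Prime (lookup q i)) →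
                       (∀ i i′ → lookup q i ≡ lookup q i′ → i ≡ i′) →
                       ProductAdmissible (prodPow q j) → ExponentCollision q j
admissible⇒collision q j prime distinct
  (s , n , _ , _ , _ , X , Y , (∣X∣≡n , _ , ΣX≡s , ∏X≡p) , (∣Y∣≡n , _ , ΣY≡s , ∏Y≡p) , X≁Y)
  with product∣prodPow⇒map-prodPow q j prime X (∣-reflexive ∏X≡p)
     | product∣prodPow⇒map-prodPow q j prime Y (∣-reflexive ∏Y≡p)
... | xs , refl | ys , refl = record
  { xs           = xs
  ; ys           = ys
  ; sum≡         = trans ΣX≡s (sym ΣY≡s)
  ; length≡      = begin
      length xs                  ≡⟨ ListP.length-map (prodPow q) xs ⟨
      length (map (prodPow q) xs) ≡⟨ trans ∣X∣≡n (sym ∣Y∣≡n) ⟩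
      length (map (prodPow q) ys) ≡⟨ ListP.length-map (prodPow q) ys ⟩
      length ys                  ∎
  ; exponentSum≡ = λ ℓ → trans (exponentSum≡j xs ∏X≡p ℓ) (sym (exponentSum≡j ys ∏Y≡p ℓ))
  ; exponentSum≤ = NP.≤-reflexive ∘ exponentSum≡j xs ∏X≡p
  ; xs≁ys        = X≁Y ∘ ↭P.map⁺ (prodPow q)
  }
  where
  exponentSum≡j : ∀ zs → product (map (prodPow q) zs) ≡ prodPow q j →
                  ∀ ℓ → exponentSum ℓ zs ≡ lookup j ℓ
  exponentSum≡j zs ∏≡p ℓ = trans (sym (lookup-vecSum ℓ zs))
    (cong (λ v → lookup v ℓ) (prodPow-injective q prime distinct
      (trans (sym (product-map-prodPow q zs)) ∏≡p)))

collision⇒witness : ∀ {k} (q j : Vec ℕ k) → ExponentCollision q j → WitnessPolynomial q j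
collision⇒witness {k} q j c =
  d , χ , supported , nonzero ,
  trans (eval-⊖ (toℤ q) (prodPow q) (monomial-toℤ q)) (≡⇒⊖≡0 sum≡) ,
  (λ ℓ → trans (eval-partial-ones ℓ) (≡⇒⊖≡0 (exponentSum≡ ℓ))) ,
  (λ ℓ → NP.≤-trans (absCoeffSum-partial-≤ ℓ) (twice-bound ℓ)) ,
  trans (eval-⊖ (ones k) (λ _ → 1) monomial-ones)
        (≡⇒⊖≡0 (trans (sum-map-1 xs) (trans length≡ (sym (sum-map-1 ys)))))
  where
  open ExponentCollision c
  d : ℕ
  d = sum (map Vec.sum (xs ++ ys))
  xs∈box : All (InBox d) xs
  xs∈box = proj₁ (AllP.++⁻ xs (inBox-bound (xs ++ ys)))
  ys∈box : All (InBox d) ys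
  ys∈box = proj₂ (AllP.++⁻ xs (inBox-bound (xs ++ ys)))
  χ : Coeffs k
  χ e = multiplicity e xs ⊖ multiplicity e ys
  open DifferencePolynomial d xs∈box ys∈box χ (λ _ → refl)
  supported : SupportedIn d χ
  supported e e∉box = cong₂ _⊖_ (multiplicity-∉ (outside xs∈box)) (multiplicity-∉ (outside ys∈box))
    where
    outside : ∀ {zs} → All (InBox d) zs → All (e ≢_) zs
    outside = All.map λ v∈box e≡v → e∉box (subst (InBox d) (sym e≡v) v∈box)
  nonzero : NonzeroPoly χ
  nonzero with multiplicities-differ xs≁ys
  ... | e , differ = e , differ ∘ ⊖≡0⇒≡
  twice-bound : ∀ ℓ → exponentSum ℓ xs + exponentSum ℓ ys ≤ 2 * lookup j ℓ
  twice-bound ℓ = NP.≤-trans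
    (NP.+-mono-≤ (exponentSum≤ ℓ) (subst (_≤ lookup j ℓ) (exponentSum≡ ℓ) (exponentSum≤ ℓ)))
    (NP.≤-reflexive (cong (_+_ (lookup j ℓ)) (sym (NP.+-identityʳ (lookup j ℓ)))))

witness⇒collision : ∀ {k} (q j : Vec ℕ k) → WitnessPolynomial q j → ExponentCollision q j
witness⇒collision {k} q j (d , χ , supported , (e₀ , χe₀≢0) , χ[q]≡0 , ∂χ[1]≡0 , ∂χ-bound , χ[1]≡0) = record
  { xs           = xs
  ; ys           = ys
  ; sum≡         = ⊖≡0⇒≡ (trans (sym (eval-⊖ (toℤ q) (prodPow q) (monomial-toℤ q))) χ[q]≡0)
  ; length≡      = trans (sym (sum-map-1 xs))
                     (trans (⊖≡0⇒≡ (trans (sym (eval-⊖ (ones k) (λ _ → 1) monomial-ones)) χ[1]≡0))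
                            (sum-map-1 ys))
  ; exponentSum≡ = exponentSum≡
  ; exponentSum≤ = exponentSum≤
  ; xs≁ys        = λ xs↭ys → χe₀≢0 (trans (χ-coeff e₀) (≡⇒⊖≡0 (multiplicity-↭ e₀ xs↭ys)))
  }
  where
  xs ys : List (Vec ℕ k)
  xs = withMultiplicity d (positivePart ∘ χ)
  ys = withMultiplicity d (negativePart ∘ χ)
  multiplicity-xs : ∀ e → multiplicity e xs ≡ positivePart (χ e)
  multiplicity-xs = multiplicity-withMultiplicity d _ (λ e → cong positivePart ∘ supported e)
  multiplicity-ys : ∀ e → multiplicity e ys ≡ negativePart (χ e)
  multiplicity-ys = multiplicity-withMultiplicity d _ (λ e → cong negativePart ∘ supported e)
  χ-coeff : ∀ e → χ e ≡ multiplicity e xs ⊖ multiplicity e ys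
  χ-coeff e = trans (sym (positivePart⊖negativePart (χ e)))
                    (cong₂ _⊖_ (sym (multiplicity-xs e)) (sym (multiplicity-ys e)))
  open DifferencePolynomial d (withMultiplicity-inBox d _) (withMultiplicity-inBox d _) χ χ-coeff
  exponentSum≡ : ∀ ℓ → exponentSum ℓ xs ≡ exponentSum ℓ ys
  exponentSum≡ ℓ = ⊖≡0⇒≡ (trans (sym (eval-partial-ones ℓ)) (∂χ[1]≡0 ℓ))
  disjoint : ∀ e → multiplicity e xs ≡ 0 ⊎ multiplicity e ys ≡ 0
  disjoint e with positivePart≡0⊎negativePart≡0 (χ e)
  ... | inj₁ ≡0 = inj₁ (trans (multiplicity-xs e) ≡0)
  ... | inj₂ ≡0 = inj₂ (trans (multiplicity-ys e) ≡0)
  exponentSum≤ : ∀ ℓ → exponentSum ℓ xs ≤ lookup j ℓ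
  exponentSum≤ ℓ = NP.*-cancelˡ-≤ 2 (subst (_≤ 2 * lookup j ℓ) twice (∂χ-bound ℓ))
    where
    twice : absCoeffSum d (partial ℓ χ) ≡ 2 * exponentSum ℓ xs
    twice = begin
      absCoeffSum d (partial ℓ χ)         ≡⟨ absCoeffSum-partial-≡ ℓ disjoint ⟩
      exponentSum ℓ xs + exponentSum ℓ ys ≡⟨ cong (_+_ (exponentSum ℓ xs)) (sym (exponentSum≡ ℓ)) ⟩
      exponentSum ℓ xs + exponentSum ℓ xs ≡⟨ cong (_+_ (exponentSum ℓ xs)) (NP.+-identityʳ _) ⟨
      2 * exponentSum ℓ xs                ∎

collision⇒admissible : ∀ {k} (q j : Vec ℕ k) → (∀ i → Prime (lookup q i)) →
                       (∀ i i′ → lookup q i ≡ lookup q i′ → i ≡ i′) →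
                       ExponentCollision q j → ProductAdmissible (prodPow q j)
collision⇒admissible {k} q j prime distinct c =
  w + sum (map (prodPow q) xs) , suc (length xs) ,
  NP.≤-trans (positive w-exponent) (NP.m≤m+n w _) , positive j , s≤s z≤n ,
  w ∷ map (prodPow q) xs , w ∷ map (prodPow q) ys ,
  (cong suc (ListP.length-map (prodPow q) xs) , positive w-exponent ∷ all-positive xs ,
   refl , product≡ xs refl) ,
  (cong suc (trans (ListP.length-map (prodPow q) ys) (sym length≡)) , positive w-exponent ∷ all-positive ys ,
   cong (_+_ w) (sym sum≡) , product≡ ys (sym (vecSum-≡ {xs = xs} {ys} exponentSum≡))) ,
  xs≁ys ∘ ↭-map⁻ (prodPow q) (prodPow-injective q prime distinct) ∘ ↭P.drop-∷
  where
  open ExponentCollision c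
  positive : ∀ e → 1 ≤ prodPow q e
  positive = prodPow-positive q (prime⇒nonZero ∘ prime)
  all-positive : ∀ zs → All (1 ≤_) (map (prodPow q) zs)
  all-positive zs = AllP.map⁺ (All.universal positive zs)
  t w-exponent : Vec ℕ k
  t          = vecSum xs
  w-exponent = zipWith _∸_ j t
  w : ℕ
  w = prodPow q w-exponent
  product≡ : ∀ zs → vecSum zs ≡ t → w * product (map (prodPow q) zs) ≡ prodPow q j
  product≡ zs zs≡t = begin
    w * product (map (prodPow q) zs) ≡⟨ cong (w *_) (product-map-prodPow q zs) ⟩
    w * prodPow q (vecSum zs)        ≡⟨ cong (λ v → w * prodPow q v) zs≡t ⟩
    w * prodPow q t                  ≡⟨ prodPow-∸-* q j t t≤j ⟩
    prodPow q j                      ∎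
    where
    t≤j : ∀ ℓ → lookup t ℓ ≤ lookup j ℓ
    t≤j ℓ = subst (_≤ lookup j ℓ) (sym (lookup-vecSum ℓ xs)) (exponentSum≤ ℓ)

theorem3p1 : (k : ℕ) (q j : Vec ℕ k) →
    (∀ i → Prime (lookup q i)) →
    (∀ i i′ → lookup q i ≡ lookup q i′ → i ≡ i′) →
    (∀ i → 1 ≤ lookup j i) →
    ProductAdmissible (prodPow q j) ⇔
      (Σ ℕ λ d → Σ (Coeffs k) λ χ →
         SupportedIn d χ × NonzeroPoly χ ×
         eval d χ (toℤ q) ≡ + 0 ×
         (∀ (ℓ : Fin k) → eval d (partial ℓ χ) (ones k) ≡ + 0) ×
         (∀ (ℓ : Fin k) → absCoeffSum d (partial ℓ χ) ≤ 2 * lookup j ℓ) ×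
         eval d χ (ones k) ≡ + 0)
theorem3p1 k q j prime distinct _ = mk⇔
  (collision⇒witness q j ∘ admissible⇒collision q j prime distinct)
  (collision⇒admissible q j prime distinct ∘ witness⇒collision q j)
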